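{- Let $K$ be a quadratic field and suppose $c\in K$ is such that $f(z)=z^2+c$ has exactly one fixed point in $K$. Then $c=1/4$, and the directed graph $G(f,K)$ is isomorphic to: the graph 6(2,1) if $K=\mathbb Q(i)$; the graph 4(1) if $K=\mathbb Q(\sqrt{ -3})$; the graph 2(1) otherwise.
   Context: $G(f,K)$ is the directed graph whose vertices are the elements of $K$ with finite forward orbit under $f$, with edges $x\to f(x)$. Graph 2(1): vertices $a,b$, edges $a\to a$, $b\to a$. Graph 4(1): vertices $a,b,d,e$, edges $a\to a$, $b\to a$, $d\to b$, $e\to b$. Graph 6(2,1): vertices $a,b,u_1,u_2,w_1,w_2$, edges $a\to a$, $b\to a$, $u_1\to u_2\to u_1$, $w_1\to u_1$, $w_2\to u_2$. -}

module Defs where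

open import Data.Nat as ℕ using (ℕ; zero; suc)
open import Data.Nat.Divisibility using (_∣_)
open import Data.Integer as ℤ using (ℤ; +_; -[1+_]; ∣_∣)
open import Data.Rational as ℚ using (ℚ; _/_)
open import Data.Fin using (Fin; zero; suc)
open import Data.Product using (Σ; ∃; ∃-syntax; _×_; _,_)
open import Relation.Binary.PropositionalEquality using (_≡_)
open import Relation.Nullary using (¬_)

-- A square-free integer d: the only natural m with m² ∣ |d| is m = 1.
-- (m = 0 excludes d = 0.)
SquareFree : ℤ → Set
SquareFree d = ∀ (m : ℕ) → (m ℕ.* m) ∣ ∣ d ∣ → m ≡ 1

-- The quadratic field K = ℚ(√d), d square-free, d ≠ 1.
-- Elements are a + b√d, represented as pairs (a , b) of rationals.
K : ℤ → Set
K d = ℚ × ℚ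

module _ (d : ℤ) where
  private dq = d / 1

  addK : K d → K d → K d
  addK (a , b) (a' , b') = (a ℚ.+ a') , (b ℚ.+ b')

  mulK : K d → K d → K d
  mulK (a , b) (a' , b') = ((a ℚ.* a') ℚ.+ (dq ℚ.* (b ℚ.* b'))) , ((a ℚ.* b') ℚ.+ (b ℚ.* a'))

  embK : ℚ → K d
  embK q = q , ℚ.0ℚ

  quadMap : K d → K d → K d
  quadMap c z = addK (mulK z z) c

iter : {A : Set} → (A → A) → ℕ → A → A
iter f zero x = x
iter f (suc n) x = f (iter f n x)

Preperiodic : {A : Set} → (A → A) → A → Set
Preperiodic f x = ∃[ m ] ∃[ n ] (¬ (m ≡ n) × iter f m x ≡ iter f n x)

-- The directed graph G(f,A) (vertices: preperiodic points, edges x → f x)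
-- is isomorphic to the functional graph on Fin k with edge map e :
-- there is an injection ψ : Fin k → A onto the preperiodic points with
-- f ∘ ψ = ψ ∘ e.
GraphIso : {A : Set} → (A → A) → (k : ℕ) → (Fin k → Fin k) → Set
GraphIso {A} f k e =
  Σ (Fin k → A) λ ψ →
    (∀ i j → ψ i ≡ ψ j → i ≡ j) ×
    (∀ i → Preperiodic f (ψ i)) ×
    (∀ x → Preperiodic f x → ∃[ i ] ψ i ≡ x) ×
    (∀ i → f (ψ i) ≡ ψ (e i))

-- Graph 2(1): a=0, b=1;  a→a, b→a
g2-1 : Fin 2 → Fin 2
g2-1 _ = zero

-- Graph 4(1): a=0, b=1, d=2, e=3;  a→a, b→a, d→b, e→b
g4-1 : Fin 4 → Fin 4
g4-1 zero = zero
g4-1 (suc zero) = zero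
g4-1 (suc (suc zero)) = suc zero
g4-1 (suc (suc (suc zero))) = suc zero

-- Graph 6(2,1): a=0, b=1, u1=2, u2=3, w1=4, w2=5;
-- a→a, b→a, u1→u2, u2→u1, w1→u1, w2→u2
g6-21 : Fin 6 → Fin 6
g6-21 zero = zero
g6-21 (suc zero) = zero
g6-21 (suc (suc zero)) = suc (suc (suc zero))
g6-21 (suc (suc (suc zero))) = suc (suc zero)
g6-21 (suc (suc (suc (suc zero)))) = suc (suc zero)
g6-21 (suc (suc (suc (suc (suc zero))))) = suc (suc (suc zero))

quarter : ℚ
quarter = + 1 / 4

{-# OPTIONS --safe #-}
-- If x is the unique fixed point of z² + c then so is 1 − x, hence x = ½ and c = ¼.
-- For z = a + b√d put t = 4a and n = 4(a² − d b²); then z ↦ z² + ¼ acts on (t, n) by the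
-- rational map G below, so preperiodic z give preperiodic points of G in ℚ².  These are
-- integral: at a prime p the exponent needed to clear the p-denominators of (t², n) more
-- than doubles under G, so along a cycle it must vanish.  They also satisfy n < 9, because
-- from n ≥ 9 on the coordinate n increases by at least 1 per step.  A preperiodic point and
-- its first two images are therefore integral points of a bounded box, and a finite search
-- leaves six values of (t, n).  For each, d b² = (t/4)² − n/4 is one of 0, −1, −3/4, 1/4;
-- since distinct square-free integers lie in distinct square classes, this forces b = 0,
-- or d = −1 and b = ±1, or d = −3 and b = ±½ (the value 1/4 would need d = 1).
module Submission where

open import Defs
open import Data.Integer using (ℤ; +_; -[1+_])
open import Data.Product using (Σ; ∃; ∃-syntax; _×_; _,_)
open import Relation.Binary.PropositionalEquality using (_≡_)
open import Relation.Nullary using (¬_)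

open import Data.Nat as ℕ using (ℕ; zero; suc)
import Data.Nat.Properties as ℕ
open import Data.Nat.Divisibility as ℕ using (_∣_; divides)
open import Data.Nat.Coprimality as Coprime using (Coprime; coprime-divisor)
open import Data.Nat.Primality using (Prime; euclidsLemma; prime⇒nonZero; prime⇒nonTrivial)
open import Data.Nat.Primality.Factorisation using (factorise)
open import Data.Nat.ListAction using (product)
open import Data.Nat.Induction using (<-rec)
open import Data.Nat.Tactic.RingSolver using () renaming (solve-∀ to ℕ-solve-∀)
import Data.Integer as ℤ
import Data.Integer.Properties as ℤ
open import Data.Integer.Tactic.RingSolver using () renaming (solve-∀ to ℤ-solve-∀)
open import Data.Rational as ℚ using (ℚ; mkℚ; _/_; 0ℚ; 1ℚ; ½; -½; _≤_; _<_; _+_; _*_; _-_; -_)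
import Data.Rational.Properties as ℚ
open import Data.Rational.Unnormalised as ℚᵘ using (ℚᵘ; mkℚᵘ; *≡*)
import Data.Rational.Unnormalised.Properties as ℚᵘ
open import Data.Fin as Fin using (Fin; zero; suc)
import Data.Fin.Properties as Fin
open import Data.Product using (∃₂; proj₁; proj₂)
import Data.Product.Properties as ×
open import Data.Sum using (_⊎_; inj₁; inj₂; [_,_]′)
open import Data.List using (List; []; _∷_)
import Data.List.Relation.Unary.All as All
open import Data.List.Relation.Unary.Any using (here; there)
open import Data.List.Membership.DecPropositional (×.≡-dec ℚ._≟_ ℚ._≟_) using (_∈_; _∈?_)
open import Function using (_∘_; id)
open import Relation.Binary.PropositionalEquality
open import Relation.Binary.Definitions using (DecidableEquality; tri<; tri≈; tri>)
open import Relation.Nullary using (Dec; yes; no; contradiction)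
open import Data.Empty using (⊥-elim)
open import Relation.Nullary.Decidable using (dec⇒maybe; toWitness; _×-dec_; _→-dec_)
open import Tactic.RingSolver using (solve-∀; solve)
open import Tactic.RingSolver.Core.AlmostCommutativeRing using (AlmostCommutativeRing; fromCommutativeRing)

module _ {A : Set} (f : A → A) where

  iter-+ : ∀ m n x → iter f (m ℕ.+ n) x ≡ iter f m (iter f n x)
  iter-+ zero    n x = refl
  iter-+ (suc m) n x = cong f (iter-+ m n x)

  EventuallyPeriodic : A → Set
  EventuallyPeriodic x = ∃₂ λ m L → iter f (suc L) (iter f m x) ≡ iter f m x

  periodic-from-< : ∀ {m n x} → m ℕ.< n → iter f m x ≡ iter f n x →
                    iter f (suc (n ℕ.∸ suc m)) (iter f m x) ≡ iter f m x
  periodic-from-< {m} {n} {x} m<n eq = begin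
    iter f (suc L) (iter f m x) ≡⟨ iter-+ (suc L) m x ⟨
    iter f (suc L ℕ.+ m) x      ≡⟨ cong (λ k → iter f k x) (ℕ.+-suc L m) ⟨
    iter f (L ℕ.+ suc m) x      ≡⟨ cong (λ k → iter f k x) (ℕ.m∸n+n≡m m<n) ⟩
    iter f n x                  ≡⟨ eq ⟨
    iter f m x                  ∎
    where
    open ≡-Reasoning
    L = n ℕ.∸ suc m

  preperiodic⇒eventuallyPeriodic : ∀ {x} → Preperiodic f x → EventuallyPeriodic x
  preperiodic⇒eventuallyPeriodic (m , n , m≢n , eq) with ℕ.<-cmp m n
  ... | tri< m<n _ _ = m , n ℕ.∸ suc m , periodic-from-< m<n eq
  ... | tri≈ _ m≡n _ = contradiction m≡n m≢n
  ... | tri> _ _ n<m = n , m ℕ.∸ suc n , periodic-from-< n<m (sym eq)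

module _ {A B : Set} {f : A → A} {g : B → B} (h : A → B)
         (h∘f≡g∘h : ∀ x → h (f x) ≡ g (h x)) where

  iter-semiconj : ∀ n x → h (iter f n x) ≡ iter g n (h x)
  iter-semiconj zero    x = refl
  iter-semiconj (suc n) x = trans (h∘f≡g∘h (iter f n x)) (cong g (iter-semiconj n x))

  preperiodic-semiconj : ∀ {x} → Preperiodic f x → Preperiodic g (h x)
  preperiodic-semiconj {x} (m , n , m≢n , eq) =
    m , n , m≢n , trans (sym (iter-semiconj m x)) (trans (cong h eq) (iter-semiconj n x))

preperiodic-step : ∀ {A : Set} {f : A → A} {x} → Preperiodic f x → Preperiodic f (f x)
preperiodic-step {f = f} = preperiodic-semiconj f (λ _ → refl)

preperiodic-Fin : ∀ {k} (e : Fin k → Fin k) i → Preperiodic e i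
preperiodic-Fin {k} e i with Fin.pigeonhole (ℕ.n<1+n k) (λ j → iter e (Fin.toℕ j) i)
... | j₁ , j₂ , j₁<j₂ , eq = Fin.toℕ j₁ , Fin.toℕ j₂ , ℕ.<⇒≢ j₁<j₂ , eq

graphIso : ∀ {A : Set} {f : A → A} {k} {e : Fin k → Fin k} (ψ : Fin k → A) →
           (∀ i j → ψ i ≡ ψ j → i ≡ j) → (∀ i → f (ψ i) ≡ ψ (e i)) →
           (∀ x → Preperiodic f x → ∃[ i ] ψ i ≡ x) → GraphIso f k e
graphIso {e = e} ψ injective edge covers =
  ψ , injective , (λ i → preperiodic-semiconj ψ (sym ∘ edge) (preperiodic-Fin e i)) , covers , edge

-- The zero test lets the solver cancel coefficients that add up to 0.
ℚ-ring : AlmostCommutativeRing _ _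
ℚ-ring = fromCommutativeRing ℚ.+-*-commutativeRing (λ x → dec⇒maybe (0ℚ ℚ.≟ x))

module _ (d : ℤ) where

  private D = d / 1

  reflect : K d → K d
  reflect (a , b) = 1ℚ - a , - b

  reflect-fixed : ∀ c x → quadMap d c x ≡ x → quadMap d c (reflect x) ≡ reflect x
  reflect-fixed (c₁ , c₂) (a , b) fx = cong₂ _,_ first second
    where
    open ≡-Reasoning
    expand₁ : ∀ a b c D → (1ℚ - a) * (1ℚ - a) + D * (- b * - b) + c ≡
                         1ℚ - (a + a) + (a * a + D * (b * b) + c)
    expand₁ = solve-∀ ℚ-ring
    expand₂ : ∀ a b c → (1ℚ - a) * - b + - b * (1ℚ - a) + c ≡
                       - (b + b) + (a * b + b * a + c)
    expand₂ = solve-∀ ℚ-ring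
    first : (1ℚ - a) * (1ℚ - a) + D * (- b * - b) + c₁ ≡ 1ℚ - a
    first = begin
      (1ℚ - a) * (1ℚ - a) + D * (- b * - b) + c₁ ≡⟨ expand₁ a b c₁ D ⟩
      1ℚ - (a + a) + (a * a + D * (b * b) + c₁)     ≡⟨ cong (λ u → 1ℚ - (a + a) + u) (cong proj₁ fx) ⟩
      1ℚ - (a + a) + a                                        ≡⟨ solve (a ∷ []) ℚ-ring ⟩
      1ℚ - a                                                      ∎
    second : (1ℚ - a) * - b + - b * (1ℚ - a) + c₂ ≡ - b
    second = begin
      (1ℚ - a) * - b + - b * (1ℚ - a) + c₂ ≡⟨ expand₂ a b c₂ ⟩
      - (b + b) + (a * b + b * a + c₂)       ≡⟨ cong (λ u → - (b + b) + u) (cong proj₂ fx) ⟩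
      - (b + b) + b                                  ≡⟨ solve (b ∷ []) ℚ-ring ⟩
      - b                                                ∎

  self-reflect : ∀ x → reflect x ≡ x → x ≡ (½ , 0ℚ)
  self-reflect (a , b) eq = cong₂ _,_ a≡½ b≡0
    where
    open ≡-Reasoning
    a≡½ : a ≡ ½
    a≡½ = begin
      a                       ≡⟨ solve (a ∷ []) ℚ-ring ⟩
      ½ * (a + a)         ≡⟨ cong (λ u → ½ * (u + a)) (cong proj₁ eq) ⟨
      ½ * (1ℚ - a + a)  ≡⟨ solve (a ∷ []) ℚ-ring ⟩
      ½                       ∎
    b≡0 : b ≡ 0ℚ
    b≡0 = begin
      b                       ≡⟨ solve (b ∷ []) ℚ-ring ⟩
      ½ * (b + b)         ≡⟨ cong (λ u → ½ * (u + b)) (cong proj₂ eq) ⟨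
      ½ * (- b + b)     ≡⟨ solve (b ∷ []) ℚ-ring ⟩
      0ℚ                      ∎

  fixing-½ : ∀ c → quadMap d c (½ , 0ℚ) ≡ (½ , 0ℚ) → c ≡ embK d quarter
  fixing-½ (c₁ , c₂) eq = cong₂ _,_ c₁≡¼ c₂≡0
    where
    open ≡-Reasoning
    c₁≡¼ : c₁ ≡ quarter
    c₁≡¼ = begin
      c₁                                                ≡⟨ solve (c₁ ∷ []) ℚ-ring ⟩
      ½ * ½ + 0ℚ + c₁ - ½ * ½                  ≡⟨ cong (λ u → ½ * ½ + u + c₁ - ½ * ½) (ℚ.*-zeroʳ D) ⟨
      ½ * ½ + D * (0ℚ * 0ℚ) + c₁ - ½ * ½  ≡⟨ cong (_- ½ * ½) (cong proj₁ eq) ⟩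
      ½ - ½ * ½                                     ∎
    c₂≡0 : c₂ ≡ 0ℚ
    c₂≡0 = begin
      c₂                                            ≡⟨ solve (c₂ ∷ []) ℚ-ring ⟩
      ½ * 0ℚ + 0ℚ * ½ + c₂ - 0ℚ           ≡⟨ cong (_- 0ℚ) (cong proj₂ eq) ⟩
      0ℚ - 0ℚ                                     ∎

  unique-fixed-point⇒c≡¼ : ∀ c → ∃[ x ] (quadMap d c x ≡ x × (∀ y → quadMap d c y ≡ y → y ≡ x)) →
                           c ≡ embK d quarter
  unique-fixed-point⇒c≡¼ c (x , fx , unique) =
    fixing-½ c (subst (λ y → quadMap d c y ≡ y) (self-reflect x x-self-reflect) fx)
    where
    x-self-reflect : reflect x ≡ x
    x-self-reflect = unique (reflect x) (reflect-fixed c x fx)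

G : ℚ × ℚ → ℚ × ℚ
G (t , n) = ½ * (t * t) - n + 1ℚ , quarter * ((n - 1ℚ) * (n - 1ℚ) + t * t)

traceNorm : (d : ℤ) → K d → ℚ × ℚ
traceNorm d (a , b) = + 4 / 1 * a , + 4 / 1 * (a * a - d / 1 * (b * b))

f¼ : (d : ℤ) → K d → K d
f¼ d = quadMap d (embK d quarter)

traceNorm-semiconj : ∀ d z → traceNorm d (f¼ d z) ≡ G (traceNorm d z)
traceNorm-semiconj d (a , b) = cong₂ _,_ (trace a b (d / 1)) (norm a b (d / 1))
  where
  trace : ∀ a b D → + 4 / 1 * (a * a + D * (b * b) + quarter) ≡
          ½ * ((+ 4 / 1 * a) * (+ 4 / 1 * a)) - + 4 / 1 * (a * a - D * (b * b)) + 1ℚ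
  trace = solve-∀ ℚ-ring
  norm : ∀ a b D → let x = a * a + D * (b * b) + quarter ; y = a * b + b * a + 0ℚ
                       n = + 4 / 1 * (a * a - D * (b * b)) ; t = + 4 / 1 * a in
         + 4 / 1 * (x * x - D * (y * y)) ≡ quarter * ((n - 1ℚ) * (n - 1ℚ) + t * t)
  norm = solve-∀ ℚ-ring

module LocalRing (p : ℕ) (p-prime : Prime p) where

  infix 4 _∈ℤ₍ₚ₎ᵘ _∈ℤ₍ₚ₎

  record _∈ℤ₍ₚ₎ᵘ (x : ℚᵘ) : Set where
    constructor cleared
    field
      numerator   : ℤ
      denominator : ℕ
      p∤denominator : ¬ p ∣ denominator
      cross : ℚᵘ.↥ x ℤ.* + denominator ≡ numerator ℤ.* ℚᵘ.↧ x

  record _∈ℤ₍ₚ₎ (q : ℚ) : Set where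
    constructor integral
    field unnormalised : ℚ.toℚᵘ q ∈ℤ₍ₚ₎ᵘ

  p≢1 : p ≢ 1
  p≢1 refl with prime⇒nonTrivial p-prime
  ... | ()

  p∤1 : ¬ p ∣ 1
  p∤1 p∣1 = p≢1 (ℕ.∣1⇒≡1 p∣1)

  p∤* : ∀ {m n} → ¬ p ∣ m → ¬ p ∣ n → ¬ p ∣ m ℕ.* n
  p∤* {m} {n} p∤m p∤n p∣mn with euclidsLemma m n p-prime p∣mn
  ... | inj₁ p∣m = p∤m p∣m
  ... | inj₂ p∣n = p∤n p∣n

  ∈ℤ₍ₚ₎ᵘ-resp-≃ : ∀ {x y} → x ℚᵘ.≃ y → x ∈ℤ₍ₚ₎ᵘ → y ∈ℤ₍ₚ₎ᵘ
  ∈ℤ₍ₚ₎ᵘ-resp-≃ {mkℚᵘ m d} {mkℚᵘ n e} (*≡* m*e≡n*d) (cleared i b p∤b m*b≡i*d) =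
    cleared i b p∤b (ℤ.*-cancelʳ-≡ _ _ (+ suc d) (begin
      n ℤ.* + b ℤ.* + suc d   ≡⟨ swap n (+ b) (+ suc d) ⟩
      n ℤ.* + suc d ℤ.* + b   ≡⟨ cong (ℤ._* + b) m*e≡n*d ⟨
      m ℤ.* + suc e ℤ.* + b   ≡⟨ swap m (+ suc e) (+ b) ⟩
      m ℤ.* + b ℤ.* + suc e   ≡⟨ cong (ℤ._* + suc e) m*b≡i*d ⟩
      i ℤ.* + suc d ℤ.* + suc e ≡⟨ swap i (+ suc d) (+ suc e) ⟩
      i ℤ.* + suc e ℤ.* + suc d ∎))
    where
    open ≡-Reasoning
    swap : ∀ x y z → x ℤ.* y ℤ.* z ≡ x ℤ.* z ℤ.* y
    swap = ℤ-solve-∀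

  ∈ℤ₍ₚ₎ᵘ-+ : ∀ {x y} → x ∈ℤ₍ₚ₎ᵘ → y ∈ℤ₍ₚ₎ᵘ → x ℚᵘ.+ y ∈ℤ₍ₚ₎ᵘ
  ∈ℤ₍ₚ₎ᵘ-+ {mkℚᵘ m d} {mkℚᵘ n e} (cleared i b p∤b eq₁) (cleared j c p∤c eq₂) =
    cleared (i ℤ.* + c ℤ.+ j ℤ.* + b) (b ℕ.* c) (p∤* p∤b p∤c) (begin
      (m ℤ.* + suc e ℤ.+ n ℤ.* + suc d) ℤ.* + (b ℕ.* c)
        ≡⟨ cong ((m ℤ.* + suc e ℤ.+ n ℤ.* + suc d) ℤ.*_) (ℤ.pos-* b c) ⟩
      (m ℤ.* + suc e ℤ.+ n ℤ.* + suc d) ℤ.* (+ b ℤ.* + c)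
        ≡⟨ expand m n (+ suc d) (+ suc e) (+ b) (+ c) ⟩
      (m ℤ.* + b) ℤ.* (+ suc e ℤ.* + c) ℤ.+ (n ℤ.* + c) ℤ.* (+ suc d ℤ.* + b)
        ≡⟨ cong₂ (λ u v → u ℤ.* (+ suc e ℤ.* + c) ℤ.+ v ℤ.* (+ suc d ℤ.* + b)) eq₁ eq₂ ⟩
      (i ℤ.* + suc d) ℤ.* (+ suc e ℤ.* + c) ℤ.+ (j ℤ.* + suc e) ℤ.* (+ suc d ℤ.* + b)
        ≡⟨ collect i j (+ suc d) (+ suc e) (+ b) (+ c) ⟩
      (i ℤ.* + c ℤ.+ j ℤ.* + b) ℤ.* (+ suc d ℤ.* + suc e)
        ≡⟨ cong ((i ℤ.* + c ℤ.+ j ℤ.* + b) ℤ.*_) (ℤ.pos-* (suc d) (suc e)) ⟨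
      (i ℤ.* + c ℤ.+ j ℤ.* + b) ℤ.* + (suc d ℕ.* suc e)    ∎)
    where
    open ≡-Reasoning
    expand : ∀ m n D E B C → (m ℤ.* E ℤ.+ n ℤ.* D) ℤ.* (B ℤ.* C) ≡
                             (m ℤ.* B) ℤ.* (E ℤ.* C) ℤ.+ (n ℤ.* C) ℤ.* (D ℤ.* B)
    expand = ℤ-solve-∀
    collect : ∀ i j D E B C → (i ℤ.* D) ℤ.* (E ℤ.* C) ℤ.+ (j ℤ.* E) ℤ.* (D ℤ.* B) ≡
                              (i ℤ.* C ℤ.+ j ℤ.* B) ℤ.* (D ℤ.* E)
    collect = ℤ-solve-∀

  ∈ℤ₍ₚ₎ᵘ-* : ∀ {x y} → x ∈ℤ₍ₚ₎ᵘ → y ∈ℤ₍ₚ₎ᵘ → x ℚᵘ.* y ∈ℤ₍ₚ₎ᵘ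
  ∈ℤ₍ₚ₎ᵘ-* {mkℚᵘ m d} {mkℚᵘ n e} (cleared i b p∤b eq₁) (cleared j c p∤c eq₂) =
    cleared (i ℤ.* j) (b ℕ.* c) (p∤* p∤b p∤c) (begin
      (m ℤ.* n) ℤ.* + (b ℕ.* c)          ≡⟨ cong ((m ℤ.* n) ℤ.*_) (ℤ.pos-* b c) ⟩
      (m ℤ.* n) ℤ.* (+ b ℤ.* + c)        ≡⟨ interchange m n (+ b) (+ c) ⟩
      (m ℤ.* + b) ℤ.* (n ℤ.* + c)        ≡⟨ cong₂ ℤ._*_ eq₁ eq₂ ⟩
      (i ℤ.* + suc d) ℤ.* (j ℤ.* + suc e) ≡⟨ interchange i (+ suc d) j (+ suc e) ⟩
      (i ℤ.* j) ℤ.* (+ suc d ℤ.* + suc e) ≡⟨ cong ((i ℤ.* j) ℤ.*_) (ℤ.pos-* (suc d) (suc e)) ⟨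
      (i ℤ.* j) ℤ.* + (suc d ℕ.* suc e)   ∎)
    where
    open ≡-Reasoning
    interchange : ∀ w x y z → (w ℤ.* x) ℤ.* (y ℤ.* z) ≡ (w ℤ.* y) ℤ.* (x ℤ.* z)
    interchange = ℤ-solve-∀

  ∈ℤ₍ₚ₎ᵘ-neg : ∀ {x} → x ∈ℤ₍ₚ₎ᵘ → ℚᵘ.- x ∈ℤ₍ₚ₎ᵘ
  ∈ℤ₍ₚ₎ᵘ-neg {mkℚᵘ m d} (cleared i b p∤b eq) =
    cleared (ℤ.- i) b p∤b
      (trans (sym (ℤ.neg-distribˡ-* m (+ b))) (trans (cong ℤ.-_ eq) (ℤ.neg-distribˡ-* i (+ suc d))))

  ∈ℤ₍ₚ₎-+ : ∀ {q r} → q ∈ℤ₍ₚ₎ → r ∈ℤ₍ₚ₎ → q + r ∈ℤ₍ₚ₎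
  ∈ℤ₍ₚ₎-+ {q} {r} (integral q∈) (integral r∈) =
    integral (∈ℤ₍ₚ₎ᵘ-resp-≃ (ℚᵘ.≃-sym (ℚ.toℚᵘ-homo-+ q r)) (∈ℤ₍ₚ₎ᵘ-+ q∈ r∈))

  ∈ℤ₍ₚ₎-* : ∀ {q r} → q ∈ℤ₍ₚ₎ → r ∈ℤ₍ₚ₎ → q * r ∈ℤ₍ₚ₎
  ∈ℤ₍ₚ₎-* {q} {r} (integral q∈) (integral r∈) =
    integral (∈ℤ₍ₚ₎ᵘ-resp-≃ (ℚᵘ.≃-sym (ℚ.toℚᵘ-homo-* q r)) (∈ℤ₍ₚ₎ᵘ-* q∈ r∈))

  ∈ℤ₍ₚ₎-- : ∀ {q r} → q ∈ℤ₍ₚ₎ → r ∈ℤ₍ₚ₎ → q - r ∈ℤ₍ₚ₎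
  ∈ℤ₍ₚ₎-- {q} {r} q∈ (integral r∈) =
    ∈ℤ₍ₚ₎-+ q∈ (integral (∈ℤ₍ₚ₎ᵘ-resp-≃ (ℚᵘ.≃-sym (ℚ.toℚᵘ-homo‿- r)) (∈ℤ₍ₚ₎ᵘ-neg r∈)))

  integer-∈ℤ₍ₚ₎ : ∀ i → i / 1 ∈ℤ₍ₚ₎
  integer-∈ℤ₍ₚ₎ i =
    integral (∈ℤ₍ₚ₎ᵘ-resp-≃ (ℚᵘ.≃-sym (ℚ.toℚᵘ-fromℚᵘ (mkℚᵘ i 0))) (cleared i 1 p∤1 refl))

  ∣-cross : ∀ {m i b d} → m ℤ.* + b ≡ i ℤ.* + d → ℤ.∣ m ∣ ℕ.* b ≡ ℤ.∣ i ∣ ℕ.* d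
  ∣-cross {m} {i} {b} {d} eq = trans (sym (ℤ.abs-* m (+ b))) (trans (cong ℤ.∣_∣ eq) (ℤ.abs-* i (+ d)))

  p∤numerator : ∀ {A D} → Coprime A D → p ∣ D → ¬ p ∣ A
  p∤numerator cop p∣D p∣A = p≢1 (cop (p∣A , p∣D))

  ∈ℤ₍ₚ₎⇒p∤↧ : ∀ {q} → q ∈ℤ₍ₚ₎ → ¬ p ∣ ℚ.↧ₙ q
  ∈ℤ₍ₚ₎⇒p∤↧ {mkℚ num dm cop} (integral (cleared i b p∤b eq)) p∣D =
    p∤* (p∤numerator (Coprime.recompute cop) p∣D) p∤b
      (subst (p ∣_) (sym (∣-cross {num} {i} {b} {suc dm} eq)) (ℕ.∣-trans p∣D (ℕ.n∣m*n ℤ.∣ i ∣)))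

  p∤denominator : ∀ c {A D b I} .{{_ : ℕ.NonZero c}} → c ∣ p → Coprime A D → ¬ p ∣ b →
                  c ℕ.* (A ℕ.* A) ℕ.* b ≡ I ℕ.* (D ℕ.* D) → ¬ p ∣ D
  p∤denominator c {A} {D} {b} {I} c∣p cop p∤b eq p∣D =
    p∤* (p∤* p∤A p∤A) p∤b (ℕ.*-cancelˡ-∣ c (subst (c ℕ.* p ∣_) c[AAb]≡ID² c*p∣ID²))
    where
    p∤A = p∤numerator cop p∣D
    c*p∣ID² : c ℕ.* p ∣ I ℕ.* (D ℕ.* D)
    c*p∣ID² = ℕ.∣-trans (ℕ.*-pres-∣ (ℕ.∣-trans c∣p p∣D) p∣D) (ℕ.n∣m*n I)
    c[AAb]≡ID² : I ℕ.* (D ℕ.* D) ≡ c ℕ.* (A ℕ.* A ℕ.* b)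
    c[AAb]≡ID² = trans (sym eq) (ℕ.*-assoc c (A ℕ.* A) b)

  root-∈ℤ₍ₚ₎ : ∀ c {q} .{{_ : ℕ.NonZero c}} → c ∣ p → (+ c / 1) * (q * q) ∈ℤ₍ₚ₎ → q ∈ℤ₍ₚ₎
  root-∈ℤ₍ₚ₎ c {q@(mkℚ num dm cop)} c∣p (integral cq²∈) = integral (cleared num (suc dm) p∤D refl)
    where
    cq²∈ᵘ : mkℚᵘ (+ c) 0 ℚᵘ.* (mkℚᵘ num dm ℚᵘ.* mkℚᵘ num dm) ∈ℤ₍ₚ₎ᵘ
    cq²∈ᵘ = ∈ℤ₍ₚ₎ᵘ-resp-≃ (ℚᵘ.≃-trans (ℚ.toℚᵘ-homo-* (+ c / 1) (q * q))
              (ℚᵘ.*-cong (ℚ.toℚᵘ-fromℚᵘ (mkℚᵘ (+ c) 0)) (ℚ.toℚᵘ-homo-* q q))) cq²∈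
    p∤D : ¬ p ∣ suc dm
    p∤D with cq²∈ᵘ
    ... | cleared i b p∤b eq = p∤denominator c {I = ℤ.∣ i ∣} c∣p (Coprime.recompute cop) p∤b (begin
      c ℕ.* (ℤ.∣ num ∣ ℕ.* ℤ.∣ num ∣) ℕ.* b        ≡⟨ cong (ℕ._* b) ∣c*num²∣ ⟨
      ℤ.∣ + c ℤ.* (num ℤ.* num) ∣ ℕ.* b              ≡⟨ ∣-cross {+ c ℤ.* (num ℤ.* num)} {i} {b} {D²} eq ⟩
      ℤ.∣ i ∣ ℕ.* (1 ℕ.* (suc dm ℕ.* suc dm))        ≡⟨ cong (ℤ.∣ i ∣ ℕ.*_) (ℕ.*-identityˡ _) ⟩
      ℤ.∣ i ∣ ℕ.* (suc dm ℕ.* suc dm)                ∎)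
      where
      open ≡-Reasoning
      D² = 1 ℕ.* (suc dm ℕ.* suc dm)
      ∣c*num²∣ : ℤ.∣ + c ℤ.* (num ℤ.* num) ∣ ≡ c ℕ.* (ℤ.∣ num ∣ ℕ.* ℤ.∣ num ∣)
      ∣c*num²∣ = trans (ℤ.abs-* (+ c) (num ℤ.* num)) (cong (c ℕ.*_) (ℤ.abs-* num num))

  pℚ : ℚ
  pℚ = + p / 1

  G-descent : ∀ w {t n} → w ∈ℤ₍ₚ₎ →
              let (t′ , n′) = G (t , n) ; c = pℚ * (w * w) in
              c * (t′ * t′) ∈ℤ₍ₚ₎ → c * n′ ∈ℤ₍ₚ₎ → w * (t * t) ∈ℤ₍ₚ₎ × w * n ∈ℤ₍ₚ₎
  G-descent w {t} {n} w∈ ct′²∈ cn′∈ = wt²∈ , wn∈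
    where
    c = pℚ * (w * w)
    t′ = proj₁ (G (t , n))
    n′ = proj₂ (G (t , n))
    int = integer-∈ℤ₍ₚ₎
    c∈ : c ∈ℤ₍ₚ₎
    c∈ = ∈ℤ₍ₚ₎-* (int (+ p)) (∈ℤ₍ₚ₎-* w∈ w∈)
    ct′∈ : c * t′ ∈ℤ₍ₚ₎
    ct′∈ = root-∈ℤ₍ₚ₎ 1 (ℕ.1∣ p) (subst _∈ℤ₍ₚ₎ (square c t′) (∈ℤ₍ₚ₎-* c∈ ct′²∈))
      where
      square : ∀ c t′ → c * (c * (t′ * t′)) ≡ 1ℚ * ((c * t′) * (c * t′))
      square = solve-∀ ℚ-ring
    wn∈ : w * n ∈ℤ₍ₚ₎
    wn∈ = root-∈ℤ₍ₚ₎ p {{prime⇒nonZero p-prime}} ℕ.∣-refl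
            (subst _∈ℤ₍ₚ₎ (identity pℚ w t n)
              (∈ℤ₍ₚ₎-+ (∈ℤ₍ₚ₎-- (∈ℤ₍ₚ₎-* (int (+ 4)) cn′∈) (∈ℤ₍ₚ₎-* (int (+ 2)) ct′∈)) c∈))
      where
      identity : ∀ q w t n → let c  = q * (w * w)
                                 t′ = ½ * (t * t) - n + 1ℚ
                                 n′ = quarter * ((n - 1ℚ) * (n - 1ℚ) + t * t) in
                 + 4 / 1 * (c * n′) - + 2 / 1 * (c * t′) + c ≡
                 q * ((w * n) * (w * n))
      identity = solve-∀ ℚ-ring
    wt²∈ : w * (t * t) ∈ℤ₍ₚ₎
    wt²∈ = subst _∈ℤ₍ₚ₎ (regroup w t n) (∈ℤ₍ₚ₎-+ w[t²-2n]∈ (∈ℤ₍ₚ₎-* (int (+ 2)) wn∈))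
      where
      regroup : ∀ w t n → w * (t * t - + 2 / 1 * n) + + 2 / 1 * (w * n) ≡ w * (t * t)
      regroup = solve-∀ ℚ-ring
      identity : ∀ q w t n → let c = q * (w * w) ; t′ = ½ * (t * t) - n + 1ℚ in
                 + 4 / 1 * (c * (t′ * t′)) - + 8 / 1 * (c * t′) + + 4 / 1 * c ≡
                 q * ((w * (t * t - + 2 / 1 * n)) * (w * (t * t - + 2 / 1 * n)))
      identity = solve-∀ ℚ-ring
      w[t²-2n]∈ : w * (t * t - + 2 / 1 * n) ∈ℤ₍ₚ₎
      w[t²-2n]∈ = root-∈ℤ₍ₚ₎ p {{prime⇒nonZero p-prime}} ℕ.∣-refl
        (subst _∈ℤ₍ₚ₎ (identity pℚ w t n)
          (∈ℤ₍ₚ₎-+ (∈ℤ₍ₚ₎-- (∈ℤ₍ₚ₎-* (int (+ 4)) ct′²∈) (∈ℤ₍ₚ₎-* (int (+ 8)) ct′∈))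
                   (∈ℤ₍ₚ₎-* (int (+ 4)) c∈)))

  infix 8 p^_
  p^_ : ℕ → ℚ
  p^ zero  = 1ℚ
  p^ suc k = pℚ * p^ k

  p^-∈ℤ₍ₚ₎ : ∀ k → p^ k ∈ℤ₍ₚ₎
  p^-∈ℤ₍ₚ₎ zero    = integer-∈ℤ₍ₚ₎ (+ 1)
  p^-∈ℤ₍ₚ₎ (suc k) = ∈ℤ₍ₚ₎-* (integer-∈ℤ₍ₚ₎ (+ p)) (p^-∈ℤ₍ₚ₎ k)

  p^-+ : ∀ j k → p^ (j ℕ.+ k) ≡ p^ j * p^ k
  p^-+ zero    k = sym (ℚ.*-identityˡ (p^ k))
  p^-+ (suc j) k = trans (cong (pℚ *_) (p^-+ j k)) (sym (ℚ.*-assoc pℚ (p^ j) (p^ k)))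

  p^-toℚᵘ : ∀ k → ℚ.toℚᵘ (p^ k) ℚᵘ.≃ mkℚᵘ (+ (p ℕ.^ k)) 0
  p^-toℚᵘ zero    = ℚᵘ.≃-refl
  p^-toℚᵘ (suc k) = ℚᵘ.≃-trans (ℚ.toℚᵘ-homo-* pℚ (p^ k))
    (ℚᵘ.≃-trans (ℚᵘ.*-cong (ℚ.toℚᵘ-fromℚᵘ (mkℚᵘ (+ p) 0)) (p^-toℚᵘ k))
      (*≡* (cong (ℤ._* + 1) (sym (ℤ.pos-* p (p ℕ.^ k))))))

  p^-weaken : ∀ j {k q} → p^ k * q ∈ℤ₍ₚ₎ → p^ (j ℕ.+ k) * q ∈ℤ₍ₚ₎
  p^-weaken zero    q∈ = q∈
  p^-weaken (suc j) {k} {q} q∈ =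
    subst _∈ℤ₍ₚ₎ (sym (ℚ.*-assoc pℚ (p^ (j ℕ.+ k)) q)) (∈ℤ₍ₚ₎-* (integer-∈ℤ₍ₚ₎ (+ p)) (p^-weaken j q∈))

  p-power-split : ∀ n → n ≢ 0 → ∃₂ λ j b → n ≡ p ℕ.^ j ℕ.* b × ¬ p ∣ b
  p-power-split = <-rec _ split
    where
    split : ∀ n → (∀ {m} → m ℕ.< n → m ≢ 0 → ∃₂ λ j b → m ≡ p ℕ.^ j ℕ.* b × ¬ p ∣ b) →
            n ≢ 0 → ∃₂ λ j b → n ≡ p ℕ.^ j ℕ.* b × ¬ p ∣ b
    split n rec n≢0 with p ℕ.∣? n
    ... | no p∤n = 0 , n , sym (ℕ.+-identityʳ n) , p∤n
    ... | yes (divides m n≡m*p) with rec m<n m≢0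
      where
      m≢0 : m ≢ 0
      m≢0 refl = n≢0 n≡m*p
      m<n : m ℕ.< n
      m<n = subst (m ℕ.<_) (sym n≡m*p)
              (ℕ.m<m*n m p {{ℕ.≢-nonZero m≢0}} (ℕ.nonTrivial⇒n>1 p {{prime⇒nonTrivial p-prime}}))
    ... | j , b , m≡pʲb , p∤b =
      suc j , b , trans n≡m*p (trans (cong (ℕ._* p) m≡pʲb) (rotate (p ℕ.^ j) b p)) , p∤b
      where
      rotate : ∀ x b p → x ℕ.* b ℕ.* p ≡ p ℕ.* x ℕ.* b
      rotate = ℕ-solve-∀

  p^-clears : ∀ q → ∃ λ k → p^ k * q ∈ℤ₍ₚ₎
  p^-clears q@(mkℚ num dm _) with p-power-split (suc dm) (λ ())
  ... | j , b , den≡pʲb , p∤b = j , integral (∈ℤ₍ₚ₎ᵘ-resp-≃ pʲq≃ (cleared num b p∤b (begin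
      + (p ℕ.^ j) ℤ.* num ℤ.* + b    ≡⟨ rotate (+ (p ℕ.^ j)) num (+ b) ⟩
      num ℤ.* (+ (p ℕ.^ j) ℤ.* + b)  ≡⟨ cong (num ℤ.*_) (ℤ.pos-* (p ℕ.^ j) b) ⟨
      num ℤ.* + (p ℕ.^ j ℕ.* b)      ≡⟨ cong (λ k → num ℤ.* + k) (trans (sym den≡pʲb) (sym (ℕ.*-identityˡ _))) ⟩
      num ℤ.* + (1 ℕ.* suc dm)       ∎)))
    where
    open ≡-Reasoning
    rotate : ∀ x y z → x ℤ.* y ℤ.* z ≡ y ℤ.* (x ℤ.* z)
    rotate = ℤ-solve-∀
    pʲq≃ : mkℚᵘ (+ (p ℕ.^ j)) 0 ℚᵘ.* mkℚᵘ num dm ℚᵘ.≃ ℚ.toℚᵘ (p^ j * q)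
    pʲq≃ = ℚᵘ.≃-sym (ℚᵘ.≃-trans (ℚ.toℚᵘ-homo-* (p^ j) q) (ℚᵘ.*-cong (p^-toℚᵘ j) ℚᵘ.≃-refl))

  Clears : ℕ → ℚ × ℚ → Set
  Clears k (t , n) = p^ k * (t * t) ∈ℤ₍ₚ₎ × p^ k * n ∈ℤ₍ₚ₎

  clears-weaken : ∀ j {k} x → Clears k x → Clears (j ℕ.+ k) x
  clears-weaken j (t , n) (t²∈ , n∈) = p^-weaken j t²∈ , p^-weaken j n∈

  clears-exists : ∀ x → ∃ λ k → Clears k x
  clears-exists (t , n) with p^-clears (t * t) | p^-clears n
  ... | k , t²∈ | l , n∈ =
    l ℕ.+ k , p^-weaken l t²∈ , subst (λ m → p^ m * n ∈ℤ₍ₚ₎) (ℕ.+-comm k l) (p^-weaken k n∈)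

  clears-descent : ∀ k x → Clears (suc (k ℕ.+ k)) (G x) → Clears k x
  clears-descent k (t , n) (t′²∈ , n′∈) =
    G-descent (p^ k) {t} {n} (p^-∈ℤ₍ₚ₎ k)
      (subst (λ c → c * _ ∈ℤ₍ₚ₎) c≡ t′²∈) (subst (λ c → c * _ ∈ℤ₍ₚ₎) c≡ n′∈)
    where
    c≡ : p^ suc (k ℕ.+ k) ≡ pℚ * (p^ k * p^ k)
    c≡ = cong (pℚ *_) (p^-+ k k)

  clears-pullback : ∀ k x → Clears k (G x) → Clears k x
  clears-pullback k x = clears-descent k x ∘ clears-weaken (suc k) (G x)

  clears-iter-pullback : ∀ k j x → Clears k (iter G j x) → Clears k x
  clears-iter-pullback k zero    x = id
  clears-iter-pullback k (suc j) x = clears-iter-pullback k j x ∘ clears-pullback k (iter G j x)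

  periodic⇒clears-0 : ∀ L y → iter G (suc L) y ≡ y → ∀ k → Clears k y → Clears 0 y
  periodic⇒clears-0 L y Gᴸ⁺¹y≡y zero    = id
  periodic⇒clears-0 L y Gᴸ⁺¹y≡y (suc k) =
    periodic⇒clears-0 L y Gᴸ⁺¹y≡y k ∘ clears-iter-pullback k L y ∘ clears-descent k (iter G L y) ∘
    subst (λ m → Clears m (iter G (suc L) y)) (ℕ.+-suc k k) ∘ clears-weaken k (iter G (suc L) y) ∘
    subst (Clears (suc k)) (sym Gᴸ⁺¹y≡y)

  preperiodic⇒∈ℤ₍ₚ₎ : ∀ x → Preperiodic G x → proj₁ x ∈ℤ₍ₚ₎ × proj₂ x ∈ℤ₍ₚ₎
  preperiodic⇒∈ℤ₍ₚ₎ x@(t , n) pre with preperiodic⇒eventuallyPeriodic G pre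
  ... | m , L , periodic with clears-exists (iter G m x)
  ... | k , cleared-k with clears-iter-pullback 0 m x (periodic⇒clears-0 L (iter G m x) periodic k cleared-k)
  ... | t²∈ , n∈ = root-∈ℤ₍ₚ₎ 1 (ℕ.1∣ p) t²∈ , subst _∈ℤ₍ₚ₎ (ℚ.*-identityˡ n) n∈

prime-divisor : ∀ n .{{_ : ℕ.NonZero n}} → n ≢ 1 → ∃ λ p → Prime p × p ∣ n
prime-divisor n n≢1 with factorise n
... | record { factors = [] ; isFactorisation = n≡1 } = contradiction n≡1 n≢1
... | record { factors = p ∷ ps ; isFactorisation = n≡pΠ ; factorsPrime = p-prime All.∷ _ } =
  p , p-prime , divides (product ps) (trans n≡pΠ (ℕ.*-comm p (product ps)))

integral-everywhere⇒↧≡1 : ∀ q → (∀ p (p-prime : Prime p) → LocalRing._∈ℤ₍ₚ₎ p p-prime q) → ℚ.↧ₙ q ≡ 1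
integral-everywhere⇒↧≡1 q integral with ℚ.↧ₙ q ℕ.≟ 1
... | yes ↧≡1 = ↧≡1
... | no ↧≢1 with prime-divisor (ℚ.↧ₙ q) ↧≢1
...   | p , p-prime , p∣↧ = contradiction p∣↧ (LocalRing.∈ℤ₍ₚ₎⇒p∤↧ p p-prime (integral p p-prime))

preperiodic⇒integral : ∀ x → Preperiodic G x → ℚ.↧ₙ (proj₁ x) ≡ 1 × ℚ.↧ₙ (proj₂ x) ≡ 1
preperiodic⇒integral x pre =
  integral-everywhere⇒↧≡1 (proj₁ x) (λ p p-prime → proj₁ (LocalRing.preperiodic⇒∈ℤ₍ₚ₎ p p-prime x pre)) ,
  integral-everywhere⇒↧≡1 (proj₂ x) (λ p p-prime → proj₂ (LocalRing.preperiodic⇒∈ℤ₍ₚ₎ p p-prime x pre))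

square-nonNeg : ∀ q → 0ℚ ≤ q * q
square-nonNeg q with ℚ.≤-total 0ℚ q
... | inj₁ 0≤q = ℚ.nonNegative⁻¹ (q * q)
      {{ℚ.nonNeg*nonNeg⇒nonNeg q {{ℚ.nonNegative 0≤q}} q {{ℚ.nonNegative 0≤q}}}}
... | inj₂ q≤0 = ℚ.nonNegative⁻¹ (q * q)
      {{ℚ.nonPos*nonPos⇒nonPos q {{ℚ.nonPositive q≤0}} q {{ℚ.nonPositive q≤0}}}}

p≤p+q : ∀ p {q} → 0ℚ ≤ q → p ≤ p + q
p≤p+q p {q} 0≤q = subst (_≤ p + q) (ℚ.+-identityʳ p) (ℚ.+-monoʳ-≤ p 0≤q)

p≤q+p : ∀ p {q} → 0ℚ ≤ q → p ≤ q + p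
p≤q+p p {q} 0≤q = subst (_≤ q + p) (ℚ.+-identityˡ p) (ℚ.+-monoˡ-≤ p 0≤q)

p<p+1 : ∀ p → p < p + 1ℚ
p<p+1 p = subst (_< p + 1ℚ) (ℚ.+-identityʳ p) (ℚ.+-monoʳ-< p (ℚ.positive⁻¹ 1ℚ))

G-norm-grows : ∀ x → + 9 / 1 ≤ proj₂ x → proj₂ x + 1ℚ ≤ proj₂ (G x)
G-norm-grows (t , n) 9≤n = begin
  n + 1ℚ                                     ≤⟨ p≤p+q (n + 1ℚ) (ℚ.*-monoˡ-≤-nonNeg quarter 0≤excess) ⟩
  n + 1ℚ + quarter * excess t (n - + 9 / 1) ≡⟨ expand t n ⟩
  proj₂ (G (t , n))                            ∎
  where
  open ℚ.≤-Reasoning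
  excess : ℚ → ℚ → ℚ
  excess t u = u * u + + 12 / 1 * u + + 24 / 1 + t * t
  0≤u : 0ℚ ≤ n - + 9 / 1
  0≤u = ℚ.+-monoˡ-≤ (- (+ 9 / 1)) 9≤n
  0≤excess : 0ℚ ≤ excess t (n - + 9 / 1)
  0≤excess = ℚ.+-mono-≤ (ℚ.+-mono-≤ (ℚ.+-mono-≤ (square-nonNeg (n - + 9 / 1))
                                                  (ℚ.*-monoˡ-≤-nonNeg (+ 12 / 1) 0≤u))
                                    (ℚ.nonNegative⁻¹ (+ 24 / 1)))
                        (square-nonNeg t)
  expand : ∀ t n → n + 1ℚ + quarter * ((n - + 9 / 1) * (n - + 9 / 1) + + 12 / 1 * (n - + 9 / 1)
                                               + + 24 / 1 + t * t) ≡
                   quarter * ((n - 1ℚ) * (n - 1ℚ) + t * t)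
  expand = solve-∀ ℚ-ring

norm-increasing : ∀ x → + 9 / 1 ≤ proj₂ x → ∀ j → proj₂ x ≤ proj₂ (iter G j x)
norm-increasing x 9≤n zero    = ℚ.≤-refl
norm-increasing x 9≤n (suc j) =
  ℚ.≤-trans n₀≤n (ℚ.≤-trans (ℚ.<⇒≤ (p<p+1 _)) (G-norm-grows (iter G j x) (ℚ.≤-trans 9≤n n₀≤n)))
  where
    n₀≤n = norm-increasing x 9≤n j

preperiodic⇒norm<9 : ∀ x → Preperiodic G x → proj₂ x < + 9 / 1
preperiodic⇒norm<9 x pre with proj₂ x ℚ.<? + 9 / 1
... | yes n<9 = n<9
... | no  n≮9 with preperiodic⇒eventuallyPeriodic G pre
... | m , L , periodic = contradiction (ℚ.<-≤-trans (p<p+1 (proj₂ y)) y-grows) (ℚ.<-irrefl refl)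
  where
  9≤n : + 9 / 1 ≤ proj₂ x
  9≤n = ℚ.≮⇒≥ n≮9
  y = iter G m x
  9≤y : + 9 / 1 ≤ proj₂ y
  9≤y = ℚ.≤-trans 9≤n (norm-increasing x 9≤n m)
  y-grows : proj₂ y + 1ℚ ≤ proj₂ y
  y-grows = subst (λ z → proj₂ y + 1ℚ ≤ proj₂ z) periodic
    (ℚ.≤-trans (ℚ.+-monoˡ-≤ 1ℚ y≤yᴸ) (G-norm-grows (iter G L y) (ℚ.≤-trans 9≤y y≤yᴸ)))
    where
      y≤yᴸ = norm-increasing y 9≤y L

square<⇒bounded : ∀ k q → 0ℚ ≤ k → q * q < k * k → - k < q × q < k
square<⇒bounded k q 0≤k q²<k² = -k<q , below q q²<k²
  where
  below : ∀ r → r * r < k * k → r < k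
  below r r²<k² with r ℚ.<? k
  ... | yes r<k = r<k
  ... | no  r≮k = contradiction (ℚ.<-≤-trans r²<k² k²≤r²) (ℚ.<-irrefl refl)
    where
    k≤r = ℚ.≮⇒≥ r≮k
    instance
      _ = ℚ.nonNegative 0≤k
      _ = ℚ.nonNegative (ℚ.≤-trans 0≤k k≤r)
    k²≤r² : k * k ≤ r * r
    k²≤r² = ℚ.≤-trans (ℚ.*-monoˡ-≤-nonNeg k k≤r) (ℚ.*-monoʳ-≤-nonNeg r k≤r)
  negate : ∀ q → - q * - q ≡ q * q
  negate = solve-∀ ℚ-ring
  double-negate : ∀ q → - (- q) ≡ q
  double-negate = solve-∀ ℚ-ring
  -k<q : - k < q
  -k<q = subst (- k <_) (double-negate q)
           (ℚ.neg-antimono-< (below (- q) (subst (_< k * k) (sym (negate q)) q²<k²)))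

↧≡1⇒≡↥/1 : ∀ q → ℚ.↧ₙ q ≡ 1 → q ≡ ℚ.↥ q / 1
↧≡1⇒≡↥/1 (mkℚ i 0 _) refl = sym (ℚ.toℚᵘ-injective (ℚ.toℚᵘ-fromℚᵘ (mkℚᵘ i 0)))

/1-cancel-< : ∀ {i j} → i / 1 < j / 1 → i ℤ.< j
/1-cancel-< {i} {j} i<j
  with ℚᵘ.<-respʳ-≃ (ℚ.toℚᵘ-fromℚᵘ (mkℚᵘ j 0))
         (ℚᵘ.<-respˡ-≃ (ℚ.toℚᵘ-fromℚᵘ (mkℚᵘ i 0)) (ℚ.toℚᵘ-mono-< i<j))
... | ℚᵘ.*<* i*1<j*1 = subst₂ ℤ._<_ (ℤ.*-identityʳ i) (ℤ.*-identityʳ j) i*1<j*1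

integer-interval : ∀ lo i k → lo ℤ.< i → i ℤ.< lo ℤ.+ + k → ∃ λ a → a ℕ.< k × i ≡ lo ℤ.+ + a
integer-interval lo i k lo<i i<lo+k =
  ℤ.∣ i ℤ.- lo ∣ , a<k , trans (recentre i lo) (cong (λ j → lo ℤ.+ j) (sym +a≡i-lo))
  where
  recentre : ∀ i lo → i ≡ lo ℤ.+ (i ℤ.- lo)
  recentre = ℤ-solve-∀
  cancel : ∀ lo k → lo ℤ.+ k ℤ.- lo ≡ k
  cancel = ℤ-solve-∀
  +a≡i-lo : + ℤ.∣ i ℤ.- lo ∣ ≡ i ℤ.- lo
  +a≡i-lo = ℤ.0≤i⇒+∣i∣≡i (ℤ.i≤j⇒0≤j-i (ℤ.<⇒≤ lo<i))
  a<k : ℤ.∣ i ℤ.- lo ∣ ℕ.< k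
  a<k = ℤ.drop‿+<+ (subst₂ ℤ._<_ (sym +a≡i-lo) (cancel lo (+ k)) (ℤ.+-monoˡ-< (ℤ.- lo) i<lo+k))

integral-between : ∀ q lo k → ℚ.↧ₙ q ≡ 1 → lo / 1 < q → q < (lo ℤ.+ + k) / 1 →
                   ∃ λ a → a ℕ.< k × q ≡ (lo ℤ.+ + a) / 1
integral-between q lo k ↧≡1 lo<q q<hi
  with integer-interval lo (ℚ.↥ q) k (/1-cancel-< (subst (lo / 1 <_) q≡ lo<q))
                                      (/1-cancel-< (subst (_< (lo ℤ.+ + k) / 1) q≡ q<hi))
  where
    q≡ = ↧≡1⇒≡↥/1 q ↧≡1
... | a , a<k , ↥q≡ = a , a<k , trans (↧≡1⇒≡↥/1 q ↧≡1) (cong (_/ 1) ↥q≡)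

Small : ℚ × ℚ → Set
Small (t , n) = ℚ.↧ₙ t ≡ 1 × ℚ.↧ₙ n ≡ 1 × n < + 9 / 1

preperiodic⇒small : ∀ x → Preperiodic G x → Small x
preperiodic⇒small x@(t , n) pre with preperiodic⇒integral x pre
... | t-integral , n-integral = t-integral , n-integral , preperiodic⇒norm<9 x pre

sum<36 : ∀ t n → proj₂ (G (t , n)) < + 9 / 1 → (n - 1ℚ) * (n - 1ℚ) + t * t < + 6 / 1 * (+ 6 / 1)
sum<36 t n n′<9 = subst (_< + 36 / 1) (four-quarters (n - 1ℚ) t) (ℚ.*-monoʳ-<-pos (+ 4 / 1) n′<9)
  where
  four-quarters : ∀ m t → + 4 / 1 * (quarter * (m * m + t * t)) ≡ m * m + t * t
  four-quarters = solve-∀ ℚ-ring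

t-bounds : ∀ t n → proj₂ (G (t , n)) < + 9 / 1 → - (+ 6 / 1) < t × t < + 6 / 1
t-bounds t n n′<9 = square<⇒bounded (+ 6 / 1) t (ℚ.nonNegative⁻¹ (+ 6 / 1))
  (ℚ.≤-<-trans (p≤q+p (t * t) (square-nonNeg (n - 1ℚ))) (sum<36 t n n′<9))

n-bounds : ∀ t n → proj₂ (G (t , n)) < + 9 / 1 → -[1+ 5 ] / 1 + 1ℚ < n × n < + 6 / 1 + 1ℚ
n-bounds t n n′<9 = subst (-[1+ 5 ] / 1 + 1ℚ <_) (shift n) (ℚ.+-monoˡ-< 1ℚ (proj₁ m-bounds)) ,
                    subst (_< + 6 / 1 + 1ℚ) (shift n) (ℚ.+-monoˡ-< 1ℚ (proj₂ m-bounds))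
  where
  shift : ∀ n → n - 1ℚ + 1ℚ ≡ n
  shift = solve-∀ ℚ-ring
  m-bounds = square<⇒bounded (+ 6 / 1) (n - 1ℚ) (ℚ.nonNegative⁻¹ (+ 6 / 1))
    (ℚ.≤-<-trans (p≤p+q ((n - 1ℚ) * (n - 1ℚ)) (square-nonNeg t)) (sum<36 t n n′<9))

grid : ℕ → ℕ → ℚ × ℚ
grid a b = (-[1+ 5 ] ℤ.+ + a) / 1 , (-[1+ 4 ] ℤ.+ + b) / 1

small⇒grid : ∀ x → Small x → Small (G x) → ∃₂ λ a b → a ℕ.< 12 × b ℕ.< 12 × x ≡ grid a b
small⇒grid (t , n) (t-integral , n-integral , _) (_ , _ , n′<9) =
  proj₁ t-grid , proj₁ n-grid , proj₁ (proj₂ t-grid) , proj₁ (proj₂ n-grid) ,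
  cong₂ _,_ (proj₂ (proj₂ t-grid)) (proj₂ (proj₂ n-grid))
  where
  t-grid = integral-between t -[1+ 5 ] 12 t-integral (proj₁ (t-bounds t n n′<9)) (proj₂ (t-bounds t n n′<9))
  n-grid = integral-between n -[1+ 4 ] 12 n-integral (proj₁ (n-bounds t n n′<9)) (proj₂ (n-bounds t n n′<9))

small? : ∀ x → Dec (Small x)
small? (t , n) = (ℚ.↧ₙ t ℕ.≟ 1) ×-dec (ℚ.↧ₙ n ℕ.≟ 1) ×-dec (n ℚ.<? + 9 / 1)

seeds : List (ℚ × ℚ)
seeds = (+ 2 / 1 , + 1 / 1) ∷ (-[1+ 1 ] / 1 , + 1 / 1) ∷ (0ℚ , + 3 / 1) ∷ (0ℚ , -[1+ 0 ] / 1)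
      ∷ (+ 2 / 1 , + 5 / 1) ∷ (-[1+ 1 ] / 1 , + 5 / 1) ∷ []

Admissible : ℚ × ℚ → Set
Admissible x = Small (G x) → Small (G (G x)) → x ∈ seeds

grid-admissible : ∀ {a} → a ℕ.< 12 → ∀ {b} → b ℕ.< 12 → Admissible (grid a b)
grid-admissible = toWitness {a? = ℕ.allUpTo? (λ a → ℕ.allUpTo? (λ b → admissible? (grid a b)) 12) 12} _
  where
  admissible? : ∀ x → Dec (Admissible x)
  admissible? x = small? (G x) →-dec (small? (G (G x)) →-dec (x ∈? seeds))

preperiodic⇒seed : ∀ x → Preperiodic G x → x ∈ seeds
preperiodic⇒seed x pre =
  subst (_∈ seeds) (sym x≡grid)
    (grid-admissible a<12 b<12 (subst (λ y → Small (G y)) x≡grid small₁)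
                               (subst (λ y → Small (G (G y))) x≡grid small₂))
  where
  small₁ = preperiodic⇒small (G x) (preperiodic-step pre)
  small₂ = preperiodic⇒small (G (G x)) (preperiodic-step (preperiodic-step pre))
  located = small⇒grid x (preperiodic⇒small x pre) small₁
  a = proj₁ located
  b = proj₁ (proj₂ located)
  a<12 = proj₁ (proj₂ (proj₂ located))
  b<12 = proj₁ (proj₂ (proj₂ (proj₂ located)))
  x≡grid : x ≡ grid a b
  x≡grid = proj₂ (proj₂ (proj₂ (proj₂ located)))

coprime-*ʳ : ∀ {a b c} → Coprime a b → Coprime a c → Coprime a (b ℕ.* c)
coprime-*ʳ {a} {b} a⊥b a⊥c (i∣a , i∣bc) = a⊥c (i∣a , coprime-divisor i⊥b i∣bc)
  where
  i⊥b : Coprime _ b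
  i⊥b (j∣i , j∣b) = a⊥b (ℕ.∣-trans j∣i i∣a , j∣b)

coprime-square : ∀ {a b} → Coprime a b → Coprime (a ℕ.* a) (b ℕ.* b)
coprime-square a⊥b = Coprime.sym (coprime-*ʳ b²⊥a b²⊥a)
  where
    b²⊥a = Coprime.sym (coprime-*ʳ a⊥b a⊥b)

cross-multiply : ∀ d e q → d / 1 * (q * q) ≡ e / 1 → d ℤ.* (ℚ.↥ q ℤ.* ℚ.↥ q) ≡ e ℤ.* (ℚ.↧ q ℤ.* ℚ.↧ q)
cross-multiply d e q@(mkℚ u v _) dq²≡e
  with ℚᵘ.≃-trans (ℚᵘ.≃-sym (ℚᵘ.≃-trans (ℚ.toℚᵘ-homo-* (d / 1) (q * q))
                    (ℚᵘ.*-cong (ℚ.toℚᵘ-fromℚᵘ (mkℚᵘ d 0)) (ℚ.toℚᵘ-homo-* q q))))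
        (ℚᵘ.≃-trans (ℚ.toℚᵘ-cong dq²≡e) (ℚ.toℚᵘ-fromℚᵘ (mkℚᵘ e 0)))
... | *≡* eq = begin
  d ℤ.* (u ℤ.* u)                        ≡⟨ ℤ.*-identityʳ (d ℤ.* (u ℤ.* u)) ⟨
  d ℤ.* (u ℤ.* u) ℤ.* + 1                ≡⟨ eq ⟩
  e ℤ.* + (1 ℕ.* (suc v ℕ.* suc v))      ≡⟨ cong (λ k → e ℤ.* + k) (ℕ.*-identityˡ (suc v ℕ.* suc v)) ⟩
  e ℤ.* + (suc v ℕ.* suc v)              ≡⟨ cong (e ℤ.*_) (ℤ.pos-* (suc v) (suc v)) ⟩
  e ℤ.* (+ suc v ℤ.* + suc v)            ∎
  where
    open ≡-Reasoning

square-class : ∀ d e q → SquareFree d → SquareFree e → d / 1 * (q * q) ≡ e / 1 →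
               d ≡ e × (q ≡ 1ℚ ⊎ q ≡ - 1ℚ)
square-class d e q@(mkℚ u v u⊥v) sf-d sf-e dq²≡e = unit ∣u∣≡1 (ℕ.suc-injective V≡1) ℤ-eq
  where
  V = suc v
  ℤ-eq : d ℤ.* (u ℤ.* u) ≡ e ℤ.* (+ V ℤ.* + V)
  ℤ-eq = cross-multiply d e q dq²≡e
  ℕ-eq : ℤ.∣ d ∣ ℕ.* (ℤ.∣ u ∣ ℕ.* ℤ.∣ u ∣) ≡ ℤ.∣ e ∣ ℕ.* (V ℕ.* V)
  ℕ-eq = begin
    ℤ.∣ d ∣ ℕ.* (ℤ.∣ u ∣ ℕ.* ℤ.∣ u ∣)        ≡⟨ cong (ℤ.∣ d ∣ ℕ.*_) (ℤ.abs-* u u) ⟨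
    ℤ.∣ d ∣ ℕ.* ℤ.∣ u ℤ.* u ∣                ≡⟨ ℤ.abs-* d (u ℤ.* u) ⟨
    ℤ.∣ d ℤ.* (u ℤ.* u) ∣                    ≡⟨ cong ℤ.∣_∣ ℤ-eq ⟩
    ℤ.∣ e ℤ.* (+ V ℤ.* + V) ∣                ≡⟨ ℤ.abs-* e (+ V ℤ.* + V) ⟩
    ℤ.∣ e ∣ ℕ.* ℤ.∣ + V ℤ.* + V ∣            ≡⟨ cong (ℤ.∣ e ∣ ℕ.*_) (ℤ.abs-* (+ V) (+ V)) ⟩
    ℤ.∣ e ∣ ℕ.* (V ℕ.* V)                    ∎
    where
      open ≡-Reasoning
  u²⊥V² : Coprime (ℤ.∣ u ∣ ℕ.* ℤ.∣ u ∣) (V ℕ.* V)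
  u²⊥V² = coprime-square (Coprime.recompute u⊥v)
  ∣u∣≡1 : ℤ.∣ u ∣ ≡ 1
  ∣u∣≡1 = sf-e ℤ.∣ u ∣ (coprime-divisor u²⊥V²
            (subst (ℤ.∣ u ∣ ℕ.* ℤ.∣ u ∣ ∣_) (trans ℕ-eq (ℕ.*-comm ℤ.∣ e ∣ (V ℕ.* V))) (ℕ.n∣m*n ℤ.∣ d ∣)))
  V≡1 : V ≡ 1
  V≡1 = sf-d V (coprime-divisor (Coprime.sym u²⊥V²)
          (subst (V ℕ.* V ∣_) (trans (sym ℕ-eq) (ℕ.*-comm ℤ.∣ d ∣ (ℤ.∣ u ∣ ℕ.* ℤ.∣ u ∣))) (ℕ.n∣m*n ℤ.∣ e ∣)))
  unit : ∀ {u v} .{u⊥v : Coprime ℤ.∣ u ∣ (suc v)} → ℤ.∣ u ∣ ≡ 1 → v ≡ 0 →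
         d ℤ.* (u ℤ.* u) ≡ e ℤ.* (+ suc v ℤ.* + suc v) →
         d ≡ e × (mkℚ u v u⊥v ≡ 1ℚ ⊎ mkℚ u v u⊥v ≡ - 1ℚ)
  unit {+ 1}       refl refl eq = trans (sym (ℤ.*-identityʳ d)) (trans eq (ℤ.*-identityʳ e)) , inj₁ refl
  unit { -[1+ 0 ] } refl refl eq = trans (sym (ℤ.*-identityʳ d)) (trans eq (ℤ.*-identityʳ e)) , inj₂ refl

squareFree⇒≢0 : ∀ {d} → SquareFree d → d ≢ + 0
squareFree⇒≢0 sf refl with sf 0 ℕ.∣-refl
... | ()

square-zero : ∀ d q → SquareFree d → d / 1 * (q * q) ≡ 0ℚ → q ≡ 0ℚ
square-zero d q sf dq²≡0
  with ℤ.i*j≡0⇒i≡0∨j≡0 d (trans (cross-multiply d (+ 0) q dq²≡0) (ℤ.*-zeroˡ (ℚ.↧ q ℤ.* ℚ.↧ q)))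
... | inj₁ d≡0 = contradiction d≡0 (squareFree⇒≢0 sf)
... | inj₂ u²≡0 with ℤ.i*j≡0⇒i≡0∨j≡0 (ℚ.↥ q) u²≡0
...   | inj₁ u≡0 = ℚ.↥p≡0⇒p≡0 q u≡0
...   | inj₂ u≡0 = ℚ.↥p≡0⇒p≡0 q u≡0

squareFree-±1 : ∀ d → ℤ.∣ d ∣ ≡ 1 → SquareFree d
squareFree-±1 d ∣d∣≡1 m m²∣d = ℕ.m*n≡1⇒m≡1 m m (ℕ.∣1⇒≡1 (subst (m ℕ.* m ∣_) ∣d∣≡1 m²∣d))

squareFree-−3 : SquareFree -[1+ 2 ]
squareFree-−3 zero          0∣3  with ℕ.0∣⇒≡0 0∣3
... | ()
squareFree-−3 (suc zero)    _    = refl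
squareFree-−3 (suc (suc m)) m²∣3 =
  contradiction (ℕ.≤-trans (ℕ.*-mono-≤ 2≤m 2≤m) (ℕ.∣⇒≤ m²∣3)) λ { (ℕ.s≤s (ℕ.s≤s (ℕ.s≤s ()))) }
  where
    2≤m = ℕ.s≤s (ℕ.s≤s ℕ.z≤n)

-- Constructors are named after the vertices of the graphs 2(1), 4(1) and 6(2,1).
data Vertex (d : ℤ) : K d → Set where
  vertex-a  : Vertex d (½ , 0ℚ)
  vertex-b  : Vertex d (-½ , 0ℚ)
  vertex-d  : d ≡ -[1+ 2 ] → Vertex d (0ℚ , ½)
  vertex-e  : d ≡ -[1+ 2 ] → Vertex d (0ℚ , -½)
  vertex-u₁ : d ≡ -[1+ 0 ] → Vertex d (-½ , 1ℚ)
  vertex-u₂ : d ≡ -[1+ 0 ] → Vertex d (-½ , - 1ℚ)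
  vertex-w₁ : d ≡ -[1+ 0 ] → Vertex d (½ , 1ℚ)
  vertex-w₂ : d ≡ -[1+ 0 ] → Vertex d (½ , - 1ℚ)

radicand : ℚ → ℚ → ℚ
radicand t n = quarter * t * (quarter * t) - quarter * n

traceNorm-decode : ∀ d a b {t n} → traceNorm d (a , b) ≡ (t , n) →
                   a ≡ quarter * t × d / 1 * (b * b) ≡ radicand t n
traceNorm-decode d a b {t} {n} eq = a≡ , (begin
  d / 1 * (b * b)                                  ≡⟨ recover-b a b (d / 1) ⟩
  a * a - quarter * proj₂ (traceNorm d (a , b))  ≡⟨ cong₂ (λ a n → a * a - quarter * n) a≡ (cong proj₂ eq) ⟩
  radicand t n                                         ∎)
  where
  open ≡-Reasoning
  recover-a : ∀ a → a ≡ quarter * (+ 4 / 1 * a)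
  recover-a = solve-∀ ℚ-ring
  recover-b : ∀ a b D → D * (b * b) ≡ a * a - quarter * (+ 4 / 1 * (a * a - D * (b * b)))
  recover-b = solve-∀ ℚ-ring
  a≡ = trans (recover-a a) (cong (quarter *_) (cong proj₁ eq))

module _ (d : ℤ) (sf : SquareFree d) (d≢1 : d ≢ + 1) {a b t n : ℚ}
         (eq : traceNorm d (a , b) ≡ (t , n)) where

  private
    a≡ = proj₁ (traceNorm-decode d a b eq)
    db²≡ = proj₂ (traceNorm-decode d a b eq)

    vertex-at : ∀ {b′} → b ≡ b′ → Vertex d (quarter * t , b′) → Vertex d (a , b)
    vertex-at refl = subst (λ a → Vertex d (a , b)) (sym a≡)

    double : ∀ D b r → D * (b * b) ≡ r → D * ((+ 2 / 1 * b) * (+ 2 / 1 * b)) ≡ + 4 / 1 * r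
    double D b r eq = trans (expand D b) (cong (+ 4 / 1 *_) eq)
      where
      expand : ∀ D b → D * ((+ 2 / 1 * b) * (+ 2 / 1 * b)) ≡ + 4 / 1 * (D * (b * b))
      expand = solve-∀ ℚ-ring

    halve : ∀ b {r} → + 2 / 1 * b ≡ r → b ≡ ½ * r
    halve b eq = trans (split b) (cong (½ *_) eq)
      where
      split : ∀ b → b ≡ ½ * (+ 2 / 1 * b)
      split = solve-∀ ℚ-ring

  vertex-on-axis : radicand t n ≡ 0ℚ → Vertex d (quarter * t , 0ℚ) → Vertex d (a , b)
  vertex-on-axis r≡0 = vertex-at (square-zero d b sf (trans db²≡ r≡0))

  vertex-at-units : ∀ e → SquareFree e → radicand t n ≡ e / 1 →
                    (d ≡ e → Vertex d (quarter * t , 1ℚ)) → (d ≡ e → Vertex d (quarter * t , - 1ℚ)) →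
                    Vertex d (a , b)
  vertex-at-units e sf-e r≡e v₊ v₋ =
    [ (λ b≡1 → vertex-at b≡1 (v₊ d≡e)) , (λ b≡-1 → vertex-at b≡-1 (v₋ d≡e)) ]′ (proj₂ class)
    where
    class = square-class d e b sf sf-e (trans db²≡ r≡e)
    d≡e = proj₁ class

  vertex-at-halves : ∀ e → SquareFree e → + 4 / 1 * radicand t n ≡ e / 1 →
                     (d ≡ e → Vertex d (quarter * t , ½)) → (d ≡ e → Vertex d (quarter * t , -½)) →
                     Vertex d (a , b)
  vertex-at-halves e sf-e 4r≡e v₊ v₋ =
    [ (λ 2b≡1 → vertex-at (halve b 2b≡1) (v₊ d≡e)) , (λ 2b≡-1 → vertex-at (halve b 2b≡-1) (v₋ d≡e)) ]′
      (proj₂ class)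
    where
    class = square-class d e (+ 2 / 1 * b) sf sf-e (trans (double (d / 1) b _ db²≡) 4r≡e)
    d≡e = proj₁ class

seed⇒vertex : ∀ d → SquareFree d → d ≢ + 1 → ∀ a b → traceNorm d (a , b) ∈ seeds → Vertex d (a , b)
seed⇒vertex d sf d≢1 a b (here eq) =
  vertex-on-axis d sf d≢1 eq refl vertex-a
seed⇒vertex d sf d≢1 a b (there (here eq)) =
  vertex-on-axis d sf d≢1 eq refl vertex-b
seed⇒vertex d sf d≢1 a b (there (there (here eq))) =
  vertex-at-halves d sf d≢1 eq -[1+ 2 ] squareFree-−3 refl vertex-d vertex-e
seed⇒vertex d sf d≢1 a b (there (there (there (here eq)))) =
  vertex-at-halves d sf d≢1 eq (+ 1) (squareFree-±1 (+ 1) refl) refl (⊥-elim ∘ d≢1) (⊥-elim ∘ d≢1)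
seed⇒vertex d sf d≢1 a b (there (there (there (there (here eq))))) =
  vertex-at-units d sf d≢1 eq -[1+ 0 ] (squareFree-±1 -[1+ 0 ] refl) refl vertex-w₁ vertex-w₂
seed⇒vertex d sf d≢1 a b (there (there (there (there (there (here eq)))))) =
  vertex-at-units d sf d≢1 eq -[1+ 0 ] (squareFree-±1 -[1+ 0 ] refl) refl vertex-u₁ vertex-u₂

preperiodic⇒vertex : ∀ d → SquareFree d → d ≢ + 1 → ∀ z → Preperiodic (f¼ d) z → Vertex d z
preperiodic⇒vertex d sf d≢1 (a , b) pre =
  seed⇒vertex d sf d≢1 a b
    (preperiodic⇒seed (traceNorm d (a , b)) (preperiodic-semiconj (traceNorm d) (traceNorm-semiconj d) pre))

injective? : ∀ {A : Set} {k} → DecidableEquality A → (ψ : Fin k → A) → Dec (∀ i j → ψ i ≡ ψ j → i ≡ j)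
injective? _≟_ ψ = Fin.all? λ i → Fin.all? λ j → (ψ i ≟ ψ j) →-dec (i Fin.≟ j)

_≟ℚ²_ : DecidableEquality (ℚ × ℚ)
_≟ℚ²_ = ×.≡-dec ℚ._≟_ ℚ._≟_

graph-ℚ⟨i⟩ : GraphIso (f¼ -[1+ 0 ]) 6 g6-21
graph-ℚ⟨i⟩ = graphIso ψ (toWitness {a? = injective? _≟ℚ²_ ψ} _)
  (toWitness {a? = Fin.all? λ i → f¼ -[1+ 0 ] (ψ i) ≟ℚ² ψ (g6-21 i)} _) covers
  where
  ψ : Fin 6 → K -[1+ 0 ]
  ψ zero                               = ½ , 0ℚ
  ψ (suc zero)                         = -½ , 0ℚ
  ψ (suc (suc zero))                   = -½ , 1ℚ
  ψ (suc (suc (suc zero)))             = -½ , - 1ℚ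
  ψ (suc (suc (suc (suc zero))))       = ½ , 1ℚ
  ψ (suc (suc (suc (suc (suc zero))))) = ½ , - 1ℚ
  covers : ∀ z → Preperiodic (f¼ -[1+ 0 ]) z → ∃ λ i → ψ i ≡ z
  covers z pre = vertex⇒index (preperiodic⇒vertex -[1+ 0 ] (squareFree-±1 -[1+ 0 ] refl) (λ ()) z pre)
    where
    vertex⇒index : ∀ {z} → Vertex -[1+ 0 ] z → ∃ λ i → ψ i ≡ z
    vertex⇒index vertex-a       = zero , refl
    vertex⇒index vertex-b       = suc zero , refl
    vertex⇒index (vertex-u₁ _) = suc (suc zero) , refl
    vertex⇒index (vertex-u₂ _) = suc (suc (suc zero)) , refl
    vertex⇒index (vertex-w₁ _) = suc (suc (suc (suc zero))) , refl
    vertex⇒index (vertex-w₂ _) = suc (suc (suc (suc (suc zero)))) , refl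

graph-ℚ⟨√-3⟩ : GraphIso (f¼ -[1+ 2 ]) 4 g4-1
graph-ℚ⟨√-3⟩ = graphIso ψ (toWitness {a? = injective? _≟ℚ²_ ψ} _)
  (toWitness {a? = Fin.all? λ i → f¼ -[1+ 2 ] (ψ i) ≟ℚ² ψ (g4-1 i)} _) covers
  where
  ψ : Fin 4 → K -[1+ 2 ]
  ψ zero                   = ½ , 0ℚ
  ψ (suc zero)             = -½ , 0ℚ
  ψ (suc (suc zero))       = 0ℚ , ½
  ψ (suc (suc (suc zero))) = 0ℚ , -½
  vertex⇒index : ∀ {z} → Vertex -[1+ 2 ] z → ∃ λ i → ψ i ≡ z
  vertex⇒index vertex-a      = zero , refl
  vertex⇒index vertex-b      = suc zero , refl
  vertex⇒index (vertex-d _)  = suc (suc zero) , refl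
  vertex⇒index (vertex-e _)  = suc (suc (suc zero)) , refl
  vertex⇒index (vertex-u₁ ())
  vertex⇒index (vertex-u₂ ())
  vertex⇒index (vertex-w₁ ())
  vertex⇒index (vertex-w₂ ())
  covers : ∀ z → Preperiodic (f¼ -[1+ 2 ]) z → ∃ λ i → ψ i ≡ z
  covers z = vertex⇒index ∘ preperiodic⇒vertex -[1+ 2 ] squareFree-−3 (λ ()) z

f¼-real : ∀ d a → f¼ d (a , 0ℚ) ≡ (a * a + 0ℚ + quarter , a * 0ℚ + 0ℚ * a + 0ℚ)
f¼-real d a = cong (λ x → (a * a + x + quarter , a * 0ℚ + 0ℚ * a + 0ℚ)) (ℚ.*-zeroʳ (d / 1))

graph-generic : ∀ d → SquareFree d → d ≢ + 1 → d ≢ -[1+ 0 ] → d ≢ -[1+ 2 ] →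
                GraphIso (f¼ d) 2 g2-1
graph-generic d sf d≢1 d≢-1 d≢-3 = graphIso ψ (toWitness {a? = injective? _≟ℚ²_ ψ} _) edges covers
  where
  ψ : Fin 2 → K d
  ψ zero       = ½ , 0ℚ
  ψ (suc zero) = -½ , 0ℚ
  edges : ∀ i → f¼ d (ψ i) ≡ ψ (g2-1 i)
  edges zero       = f¼-real d ½
  edges (suc zero) = f¼-real d -½
  vertex⇒index : ∀ {z} → Vertex d z → ∃ λ i → ψ i ≡ z
  vertex⇒index vertex-a        = zero , refl
  vertex⇒index vertex-b        = suc zero , refl
  vertex⇒index (vertex-d d≡-3)  = contradiction d≡-3 d≢-3
  vertex⇒index (vertex-e d≡-3)  = contradiction d≡-3 d≢-3
  vertex⇒index (vertex-u₁ d≡-1) = contradiction d≡-1 d≢-1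
  vertex⇒index (vertex-u₂ d≡-1) = contradiction d≡-1 d≢-1
  vertex⇒index (vertex-w₁ d≡-1) = contradiction d≡-1 d≢-1
  vertex⇒index (vertex-w₂ d≡-1) = contradiction d≡-1 d≢-1
  covers : ∀ z → Preperiodic (f¼ d) z → ∃ λ i → ψ i ≡ z
  covers z = vertex⇒index ∘ preperiodic⇒vertex d sf d≢1 z

proposition5p6 : (d : ℤ) → SquareFree d → ¬ (d ≡ + 1) → (c : K d) →
    (∃[ x ] (quadMap d c x ≡ x × (∀ y → quadMap d c y ≡ y → y ≡ x))) →
    (c ≡ embK d quarter) ×
    ((d ≡ -[1+ 0 ] → GraphIso (quadMap d c) 6 g6-21) ×
     (d ≡ -[1+ 2 ] → GraphIso (quadMap d c) 4 g4-1) ×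
     (¬ (d ≡ -[1+ 0 ]) → ¬ (d ≡ -[1+ 2 ]) → GraphIso (quadMap d c) 2 g2-1))
proposition5p6 d sf d≢1 c unique-fixed-point = c≡¼ ,
  (λ { refl → at-¼ graph-ℚ⟨i⟩ }) ,
  (λ { refl → at-¼ graph-ℚ⟨√-3⟩ }) ,
  (λ d≢-1 d≢-3 → at-¼ (graph-generic d sf d≢1 d≢-1 d≢-3))
  where
  c≡¼ = unique-fixed-point⇒c≡¼ d c unique-fixed-point
  at-¼ : ∀ {k e} → GraphIso (f¼ d) k e → GraphIso (quadMap d c) k e
  at-¼ {k} {e} = subst (λ c → GraphIso (quadMap d c) k e) (sym c≡¼)
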